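{- Let $n \ge 2$ and $\sigma \ge 2$, let $s$ be a random string of length $n$ whose characters are drawn independently and uniformly from an alphabet $\Sigma$ of size $\sigma$, and set $p = (\sigma-1)/\sigma$. Let $r(s)$ be the number of maximal runs of $s$ and $k$ the number of tokens of $\mathcal{F}(s)$. Then $r(s) - 1 \sim \mathrm{Bin}(n-1, p)$ and \[ \mathbb{E}[k] = 1 + \frac{1 + (n-1)p}{2} + \frac{1 + \bigl((2-\sigma)/\sigma\bigr)^{n-1}}{4} = \frac{n(\sigma-1)}{2\sigma} + O(1). \]
   Context: Let $\texttt{@}$ and $\texttt{\$}$ be two distinct symbols not in $\Sigma$. For $s \in \Sigma^*$ let $\hat{s} = \texttt{@}\, s\, \texttt{\$}$. The leading run of a non-empty string is its longest prefix consisting of a single repeated symbol; the trailing run is its longest suffix consisting of a single repeated symbol. The Flashback decomposition $\mathcal{F}(s)$ is a list of tokens produced as follows, starting with active span $\hat{s}$: (i) if the active span is empty, stop; (ii) let $\ell$ be the length of its leading run; if $\ell$ equals the length of the span, append (span, $0$) and stop; (iii) otherwise let $\sigma'$ be the leading run followed by the trailing run, and let the middle be the span with its leading and trailing runs removed; if the middle is empty append $(\sigma',0)$ and stop, otherwise append $(\sigma',\ell)$ and continue with the middle as the new active span. The maximal runs of a non-empty string $s$ are given by its unique run-length encoding $s = a_1^{m_1}\cdots a_r^{m_r}$ with $a_i \in \Sigma$, $m_i \ge 1$, $a_i \ne a_{i+1}$; $r(s) = r$. -}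

module Defs where

open import Data.Nat using (ℕ; zero; suc; _+_; _*_; _∸_; _≡ᵇ_)
open import Data.Bool using (Bool; true; false; if_then_else_)
open import Data.Fin using (Fin)
import Data.Fin as Fin
open import Data.List using (List; []; _∷_; length; map; concatMap; reverse; take; drop; _++_; filterᵇ)
open import Data.Nat.ListAction using (sum)
open import Data.Product using (_×_; _,_)
open import Data.Integer using (ℤ; +_)
open import Data.Rational using (ℚ; 0ℚ; 1ℚ; _/_)
import Data.Rational as ℚ
open import Relation.Nullary using (does)

data Sym (σ : ℕ) : Set where
  at     : Sym σ
  dollar : Sym σ
  ch     : Fin σ → Sym σ

_==_ : {σ : ℕ} → Sym σ → Sym σ → Bool
at     == at     = true
dollar == dollar = true
ch a   == ch b   = does (a Fin.≟ b)
_      == _      = false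

hat : {σ : ℕ} → List (Fin σ) → List (Sym σ)
hat s = at ∷ (map ch s ++ (dollar ∷ []))

prefixLen : {σ : ℕ} → Sym σ → List (Sym σ) → ℕ
prefixLen x []       = 0
prefixLen x (y ∷ ys) = if x == y then suc (prefixLen x ys) else 0

leadLen : {σ : ℕ} → List (Sym σ) → ℕ
leadLen []       = 0
leadLen (x ∷ xs) = suc (prefixLen x xs)

trailLen : {σ : ℕ} → List (Sym σ) → ℕ
trailLen xs = leadLen (reverse xs)

leadingRun : {σ : ℕ} → List (Sym σ) → List (Sym σ)
leadingRun xs = take (leadLen xs) xs

trailingRun : {σ : ℕ} → List (Sym σ) → List (Sym σ)
trailingRun xs = drop (length xs ∸ trailLen xs) xs

middle : {σ : ℕ} → List (Sym σ) → List (Sym σ)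
middle xs = take (length xs ∸ leadLen xs ∸ trailLen xs) (drop (leadLen xs) xs)

-- Flashback decomposition.  The procedure is run with a fuel argument;
-- each non-final step removes at least 2 symbols, so fuel = length + 1
-- is always enough and the fuel never runs out.

Token : ℕ → Set
Token σ = List (Sym σ) × ℕ

flashbackFuel : {σ : ℕ} → ℕ → List (Sym σ) → List (Token σ)
flashbackFuel zero    span = []
flashbackFuel (suc f) []   = []
flashbackFuel (suc f) span@(_ ∷ _) with leadLen span ≡ᵇ length span
... | true  = (span , 0) ∷ []
... | false with middle span
...   | []    = (leadingRun span ++ trailingRun span , 0) ∷ []
...   | m@(_ ∷ _) = (leadingRun span ++ trailingRun span , leadLen span)
                      ∷ flashbackFuel f m

flashbackSpan : {σ : ℕ} → List (Sym σ) → List (Token σ)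
flashbackSpan span = flashbackFuel (suc (length span)) span

flashback : {σ : ℕ} → List (Fin σ) → List (Token σ)
flashback s = flashbackSpan (hat s)

numTokens : {σ : ℕ} → List (Fin σ) → ℕ
numTokens s = length (flashback s)

rle : {σ : ℕ} → List (Fin σ) → List (Fin σ × ℕ)
rle []       = []
rle (a ∷ xs) with rle xs
... | []                  = (a , 1) ∷ []
... | ((b , m) ∷ rest)    =
  if does (a Fin.≟ b) then (b , suc m) ∷ rest else (a , 1) ∷ (b , m) ∷ rest

runs : {σ : ℕ} → List (Fin σ) → ℕ
runs s = length (rle s)

allStrings : (σ n : ℕ) → List (List (Fin σ))
allStrings σ zero    = [] ∷ []
allStrings σ (suc n) =
  concatMap (λ a → map (a ∷_) (allStrings σ n)) (Data.List.allFin σ)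
  where import Data.List

-- rational number a / b (with the convention a / 0 = 0; only used with b ≠ 0)
_/ℕ_ : ℤ → ℕ → ℚ
a /ℕ zero  = 0ℚ
a /ℕ suc b = a / suc b

ℕ→ℚ : ℕ → ℚ
ℕ→ℚ m = (+ m) / 1

_^ℚ_ : ℚ → ℕ → ℚ
q ^ℚ zero  = 1ℚ
q ^ℚ suc m = q ℚ.* (q ^ℚ m)

prob : (σ n : ℕ) → (List (Fin σ) → Bool) → ℚ
prob σ n P = (+ length (filterᵇ P (allStrings σ n))) /ℕ (length (allStrings σ n))

expect : (σ n : ℕ) → (List (Fin σ) → ℕ) → ℚ
expect σ n X = (+ sum (map X (allStrings σ n))) /ℕ (length (allStrings σ n))

binomialPMF : ℕ → ℚ → ℕ → ℚ
binomialPMF N p j =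
  ℕ→ℚ (N Data.Nat.Combinatorics.C j) ℚ.* ((p ^ℚ j) ℚ.* ((1ℚ ℚ.- p) ^ℚ (N ∸ j)))
  where import Data.Nat.Combinatorics

{-# OPTIONS --safe #-}
module Submission where

-- ŝ has r(s) + 2 maximal runs, and every non-final step of the Flashback decomposition strips
-- exactly the first and the last run of the active span, so 𝓕(s) has k = 1 + ⌈r(s)/2⌉ tokens.
-- Prepending a uniform character to a non-empty string keeps its number of runs with
-- probability 1/σ and adds one otherwise.  This gives the binomial law of r(s) - 1, and linear
-- recurrences for the sum of r and for the number of strings with r odd; their solutions are
-- E[r] = 1 + (n - 1)p and Pr[r odd] = (1 + q^(n-1))/2 with q = (2 - σ)/σ.  Since
-- 2k = 2 + r + [r odd], this gives E[k], and E[k] - np/2 = 5/4 + 1/(2σ) + q^(n-1)/4 lies in [0, 2].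

open import Defs
open import Data.Bool using (Bool; true; false; if_then_else_)
open import Data.Bool.Properties using (if-float)
open import Data.Fin using (Fin)
import Data.Fin as Fin
import Data.Integer as ℤ
import Data.Integer.Properties as ℤ
open import Data.List
  using (List; []; _∷_; [_]; length; map; reverse; take; drop; _++_; _ʳ++_; _∷ʳ_; replicate; initLast; _∷ʳ′_;
         concatMap; tabulate; allFin; filterᵇ)
import Data.List.Properties as List
open import Data.Nat using (ℕ; zero; suc; _∸_; _≡ᵇ_; ⌊_/2⌋; ⌈_/2⌉)
import Data.Nat as ℕ
import Data.Nat.Properties as ℕ
open import Data.Nat.Combinatorics using (_C_; nCk+nC[k+1]≡[n+1]C[k+1]; k>n⇒nCk≡0)
open import Data.Nat.ListAction using (sum)
open import Data.Nat.ListAction.Properties using (sum-++)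
open import Data.Product using (_,_; ∃₂)
open import Data.Sum using (inj₁; inj₂)
open import Data.Unit using (⊤)
open import Relation.Binary.PropositionalEquality hiding ([_])
open import Relation.Nullary using (does; yes; no)
open import Relation.Nullary.Decidable using (dec-true; dec-false)

module _ where
  open import Data.Nat using (_+_; _*_; _^_; _≤_; s≤s)
  open import Algebra.Properties.CommutativeSemigroup ℕ.+-commutativeSemigroup using (interchange)
  open import Data.Nat.Solver using (module +-*-Solver)
  open +-*-Solver using (solve; _:=_; _:+_; _:*_; con)

  ≡ᵇ-refl : (n : ℕ) → (n ≡ᵇ n) ≡ true
  ≡ᵇ-refl zero    = refl
  ≡ᵇ-refl (suc n) = ≡ᵇ-refl n

  ≡ᵇ-+suc : (m k : ℕ) → (m ≡ᵇ m + suc k) ≡ false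
  ≡ᵇ-+suc zero    k = refl
  ≡ᵇ-+suc (suc m) k = ≡ᵇ-+suc m k

  take-length-++ : {A : Set} (xs ys : List A) → take (length xs) (xs ++ ys) ≡ xs
  take-length-++ []       ys = refl
  take-length-++ (x ∷ xs) ys = cong (x ∷_) (take-length-++ xs ys)

  -- Runs and the Flashback decomposition

  module _ {σ : ℕ} where

    ==-refl : (x : Sym σ) → (x == x) ≡ true
    ==-refl at     = refl
    ==-refl dollar = refl
    ==-refl (ch a) = dec-true (a Fin.≟ a) refl

    ==-sym : (x y : Sym σ) → (x == y) ≡ (y == x)
    ==-sym at     at     = refl
    ==-sym at     dollar = refl
    ==-sym at     (ch _) = refl
    ==-sym dollar at     = refl
    ==-sym dollar dollar = refl
    ==-sym dollar (ch _) = refl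
    ==-sym (ch _) at     = refl
    ==-sym (ch _) dollar = refl
    ==-sym (ch a) (ch b) with a Fin.≟ b
    ... | yes refl = sym (dec-true (a Fin.≟ a) refl)
    ... | no a≢b   = sym (dec-false (b Fin.≟ a) (λ b≡a → a≢b (sym b≡a)))

    ==⇒≡ : (x y : Sym σ) → (x == y) ≡ true → x ≡ y
    ==⇒≡ at     at     _ = refl
    ==⇒≡ dollar dollar _ = refl
    ==⇒≡ (ch a) (ch b) _ with a Fin.≟ b
    ==⇒≡ (ch a) (ch b) _  | yes refl = refl
    ==⇒≡ (ch a) (ch b) () | no _
    ==⇒≡ at     dollar ()
    ==⇒≡ at     (ch _) ()
    ==⇒≡ dollar at     ()
    ==⇒≡ dollar (ch _) ()
    ==⇒≡ (ch _) at     ()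
    ==⇒≡ (ch _) dollar ()

    differ : Sym σ → Sym σ → ℕ
    differ x y = if x == y then 0 else 1

    changes : List (Sym σ) → ℕ
    changes []           = 0
    changes (_ ∷ [])     = 0
    changes (x ∷ y ∷ ys) = differ x y + changes (y ∷ ys)

    changes-ʳ++ : (xs : List (Sym σ)) (y : Sym σ) (ys : List (Sym σ)) →
                  changes (xs ʳ++ y ∷ ys) ≡ changes (y ∷ xs) + changes (y ∷ ys)
    changes-ʳ++ []       y ys = refl
    changes-ʳ++ (x ∷ xs) y ys = begin
      changes (xs ʳ++ x ∷ y ∷ ys)
        ≡⟨ changes-ʳ++ xs x (y ∷ ys) ⟩
      changes (x ∷ xs) + (differ x y + changes (y ∷ ys))
        ≡⟨ ℕ.+-assoc (changes (x ∷ xs)) _ _ ⟨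
      changes (x ∷ xs) + differ x y + changes (y ∷ ys)
        ≡⟨ cong (_+ changes (y ∷ ys)) (ℕ.+-comm (changes (x ∷ xs)) _) ⟩
      differ x y + changes (x ∷ xs) + changes (y ∷ ys)
        ≡⟨ cong (λ d → d + changes (x ∷ xs) + changes (y ∷ ys)) differ-sym ⟩
      differ y x + changes (x ∷ xs) + changes (y ∷ ys) ∎
      where
      open ≡-Reasoning
      differ-sym : differ x y ≡ differ y x
      differ-sym = cong (if_then 0 else 1) (==-sym x y)

    changes-reverse : (xs : List (Sym σ)) → changes (reverse xs) ≡ changes xs
    changes-reverse []       = refl
    changes-reverse (x ∷ xs) = trans (changes-ʳ++ xs x []) (ℕ.+-identityʳ _)

    HeadDiffers : Sym σ → List (Sym σ) → Set
    HeadDiffers x []      = ⊤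
    HeadDiffers x (y ∷ _) = (x == y) ≡ false

    prefixLen-split : (x : Sym σ) (xs : List (Sym σ)) →
                      xs ≡ replicate (prefixLen x xs) x ++ drop (prefixLen x xs) xs
    prefixLen-split x []       = refl
    prefixLen-split x (y ∷ ys) with x == y in x==y
    ... | true rewrite ==⇒≡ x y x==y = cong (y ∷_) (prefixLen-split y ys)
    ... | false = refl

    headDiffers-drop-prefixLen : (x : Sym σ) (xs : List (Sym σ)) → HeadDiffers x (drop (prefixLen x xs) xs)
    headDiffers-drop-prefixLen x []       = _
    headDiffers-drop-prefixLen x (y ∷ ys) with x == y in x==y
    ... | true  = headDiffers-drop-prefixLen x ys
    ... | false = x==y

    prefixLen-replicate-++ : (x : Sym σ) (a : ℕ) {ys : List (Sym σ)} → HeadDiffers x ys →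
                             prefixLen x (replicate a x ++ ys) ≡ a
    prefixLen-replicate-++ x zero    {[]}    _     = refl
    prefixLen-replicate-++ x zero    {_ ∷ _} x==y  rewrite x==y = refl
    prefixLen-replicate-++ x (suc a)         x≠ys  rewrite ==-refl x = cong suc (prefixLen-replicate-++ x a x≠ys)

    prefixLen-replicate : (x : Sym σ) (a : ℕ) → prefixLen x (replicate a x) ≡ a
    prefixLen-replicate x zero    = refl
    prefixLen-replicate x (suc a) rewrite ==-refl x = cong suc (prefixLen-replicate x a)

    changes-replicate-++ : (x : Sym σ) (a : ℕ) (ys : List (Sym σ)) →
                           changes (replicate (suc a) x ++ ys) ≡ changes (x ∷ ys)
    changes-replicate-++ x zero    ys = refl
    changes-replicate-++ x (suc a) ys rewrite ==-refl x = changes-replicate-++ x a ys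

    changes-replicate : (x : Sym σ) (a : ℕ) → changes (replicate (suc a) x) ≡ 0
    changes-replicate x a = trans (cong changes (sym (List.++-identityʳ (replicate (suc a) x))))
                                  (changes-replicate-++ x a [])

    changes-∷-headDiffers : (y : Sym σ) (zs : List (Sym σ)) (w : Sym σ) (ws : List (Sym σ)) →
                            HeadDiffers y (zs ++ w ∷ ws) →
                            changes (y ∷ zs ++ w ∷ ws) ≡ suc (changes (zs ++ w ∷ ws))
    changes-∷-headDiffers y []      w ws y==w rewrite y==w = refl
    changes-∷-headDiffers y (z ∷ _) w ws y==z rewrite y==z = refl

    replicate-∷ʳ : (x : Sym σ) (a : ℕ) → replicate a x ∷ʳ x ≡ replicate (suc a) x
    replicate-∷ʳ x zero    = refl
    replicate-∷ʳ x (suc a) = cong (x ∷_) (replicate-∷ʳ x a)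

    reverse-replicate : (x : Sym σ) (a : ℕ) → reverse (replicate a x) ≡ replicate a x
    reverse-replicate x zero    = refl
    reverse-replicate x (suc a) = begin
      reverse (x ∷ replicate a x)       ≡⟨ List.unfold-reverse x (replicate a x) ⟩
      reverse (replicate a x) ∷ʳ x      ≡⟨ cong (_∷ʳ x) (reverse-replicate x a) ⟩
      replicate a x ∷ʳ x                ≡⟨ replicate-∷ʳ x a ⟩
      replicate (suc a) x               ∎
      where open ≡-Reasoning

    drop-replicate-++ : (x : Sym σ) (a : ℕ) (ys : List (Sym σ)) → drop a (replicate a x ++ ys) ≡ ys
    drop-replicate-++ x zero    ys = refl
    drop-replicate-++ x (suc a) ys = drop-replicate-++ x a ys

    frame : Sym σ → ℕ → List (Sym σ) → Sym σ → ℕ → List (Sym σ)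
    frame x a M y b = replicate (suc a) x ++ M ++ replicate (suc b) y

    -- The HeadDiffers hypotheses make both outer runs maximal; the second one reads the span
    -- from the right.
    data RunFrame : List (Sym σ) → Set where
      uniform : (x : Sym σ) (a : ℕ) → RunFrame (replicate (suc a) x)
      framed  : (x : Sym σ) (a : ℕ) (M : List (Sym σ)) (y : Sym σ) (b : ℕ) →
                HeadDiffers x (M ++ replicate (suc b) y) →
                HeadDiffers y (reverse M ++ replicate (suc a) x) →
                RunFrame (frame x a M y b)

    framed-reverse : (x : Sym σ) (a : ℕ) (N : List (Sym σ)) (y : Sym σ) (b : ℕ) →
                     HeadDiffers x (reverse N ++ replicate (suc b) y) → HeadDiffers y N →
                     RunFrame (frame x a (reverse N) y b)
    framed-reverse x a []       y b x≠y _   = framed x a [] y b x≠y (trans (==-sym y x) x≠y)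
    framed-reverse x a (n ∷ ns) y b x≠N y≠n =
      framed x a (reverse (n ∷ ns)) y b x≠N
        (subst (λ zs → HeadDiffers y (zs ++ replicate (suc a) x)) (sym (List.reverse-involutive (n ∷ ns))) y≠n)

    runFrame-++ : (x : Sym σ) (a : ℕ) (rest : List (Sym σ)) → HeadDiffers x rest →
                  RunFrame (replicate (suc a) x ++ rest)
    runFrame-++ x a rest x≠rest with initLast rest
    ... | []          = subst RunFrame (sym (List.++-identityʳ _)) (uniform x a)
    ... | init ∷ʳ′ y  =
      subst (λ zs → RunFrame (replicate (suc a) x ++ zs)) (sym rest≡)
            (framed-reverse x a N y b (subst (HeadDiffers x) rest≡ x≠rest)
                                      (headDiffers-drop-prefixLen y (reverse init)))
      where
      b = prefixLen y (reverse init)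
      N = drop b (reverse init)
      open ≡-Reasoning
      rest≡ : init ∷ʳ y ≡ reverse N ++ replicate (suc b) y
      rest≡ = begin
        init ∷ʳ y
          ≡⟨ cong (_∷ʳ y) (List.reverse-involutive init) ⟨
        reverse (reverse init) ∷ʳ y
          ≡⟨ cong (λ zs → reverse zs ∷ʳ y) (prefixLen-split y (reverse init)) ⟩
        reverse (replicate b y ++ N) ∷ʳ y
          ≡⟨ cong (_∷ʳ y) (List.reverse-++ (replicate b y) N) ⟩
        (reverse N ++ reverse (replicate b y)) ∷ʳ y
          ≡⟨ cong (λ zs → (reverse N ++ zs) ∷ʳ y) (reverse-replicate y b) ⟩
        (reverse N ++ replicate b y) ∷ʳ y
          ≡⟨ List.++-assoc (reverse N) (replicate b y) [ y ] ⟩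
        reverse N ++ replicate b y ∷ʳ y
          ≡⟨ cong (reverse N ++_) (replicate-∷ʳ y b) ⟩
        reverse N ++ replicate (suc b) y ∎

    runFrame : (x : Sym σ) (xs : List (Sym σ)) → RunFrame (x ∷ xs)
    runFrame x xs =
      subst RunFrame (cong (x ∷_) (sym (prefixLen-split x xs)))
            (runFrame-++ x (prefixLen x xs) (drop (prefixLen x xs) xs) (headDiffers-drop-prefixLen x xs))

    module _ (x : Sym σ) (a : ℕ) (M : List (Sym σ)) (y : Sym σ) (b : ℕ) where

      private
        R₁ R₂ F : List (Sym σ)
        R₁ = replicate (suc a) x
        R₂ = replicate (suc b) y
        F  = frame x a M y b

      leadLen-frame : HeadDiffers x (M ++ R₂) → leadLen F ≡ suc a
      leadLen-frame x≠ = cong suc (prefixLen-replicate-++ x a x≠)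

      reverse-frame : reverse F ≡ R₂ ++ reverse M ++ R₁
      reverse-frame = begin
        reverse (R₁ ++ M ++ R₂)
          ≡⟨ List.reverse-++ R₁ (M ++ R₂) ⟩
        reverse (M ++ R₂) ++ reverse R₁
          ≡⟨ cong₂ _++_ (List.reverse-++ M R₂) (reverse-replicate x (suc a)) ⟩
        (reverse R₂ ++ reverse M) ++ R₁
          ≡⟨ cong (λ zs → (zs ++ reverse M) ++ R₁) (reverse-replicate y (suc b)) ⟩
        (R₂ ++ reverse M) ++ R₁
          ≡⟨ List.++-assoc R₂ (reverse M) R₁ ⟩
        R₂ ++ reverse M ++ R₁ ∎
        where open ≡-Reasoning

      trailLen-frame : HeadDiffers y (reverse M ++ R₁) → trailLen F ≡ suc b
      trailLen-frame y≠ = trans (cong leadLen reverse-frame) (cong suc (prefixLen-replicate-++ y b y≠))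

      length-frame : length F ≡ suc a + (length M + suc b)
      length-frame = begin
        length (R₁ ++ M ++ R₂)
          ≡⟨ List.length-++ R₁ ⟩
        length R₁ + length (M ++ R₂)
          ≡⟨ cong₂ _+_ (List.length-replicate (suc a)) (List.length-++ M) ⟩
        suc a + (length M + length R₂)
          ≡⟨ cong (λ n → suc a + (length M + n)) (List.length-replicate (suc b)) ⟩
        suc a + (length M + suc b) ∎
        where open ≡-Reasoning

      frame-not-uniform : HeadDiffers x (M ++ R₂) → (leadLen F ≡ᵇ length F) ≡ false
      frame-not-uniform x≠ =
        trans (cong₂ _≡ᵇ_ (leadLen-frame x≠) (trans length-frame (cong (suc a +_) (ℕ.+-suc (length M) b))))
              (≡ᵇ-+suc (suc a) (length M + b))

      middle-frame : HeadDiffers x (M ++ R₂) → HeadDiffers y (reverse M ++ R₁) → middle F ≡ M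
      middle-frame x≠ y≠ = begin
        take (length F ∸ leadLen F ∸ trailLen F) (drop (leadLen F) F)
          ≡⟨ cong₂ (λ l r → take (length F ∸ l ∸ r) (drop l F)) (leadLen-frame x≠) (trailLen-frame y≠) ⟩
        take (length F ∸ suc a ∸ suc b) (drop (suc a) F)
          ≡⟨ cong₂ take length-M (drop-replicate-++ x (suc a) (M ++ R₂)) ⟩
        take (length M) (M ++ R₂)
          ≡⟨ take-length-++ M R₂ ⟩
        M ∎
        where
        open ≡-Reasoning
        length-M : length F ∸ suc a ∸ suc b ≡ length M
        length-M = begin
          length F ∸ suc a ∸ suc b
            ≡⟨ cong (λ n → n ∸ suc a ∸ suc b) length-frame ⟩
          suc a + (length M + suc b) ∸ suc a ∸ suc b
            ≡⟨ cong (_∸ suc b) (ℕ.m+n∸m≡n (suc a) (length M + suc b)) ⟩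
          length M + suc b ∸ suc b
            ≡⟨ ℕ.m+n∸n≡m (length M) (suc b) ⟩
          length M ∎

    changes-frame-[] : (x : Sym σ) (a : ℕ) (y : Sym σ) (b : ℕ) →
                       HeadDiffers x (replicate (suc b) y) → changes (frame x a [] y b) ≡ 1
    changes-frame-[] x a y b x≠y = begin
      changes (replicate (suc a) x ++ R₂)  ≡⟨ changes-replicate-++ x a R₂ ⟩
      changes (x ∷ R₂)                     ≡⟨ changes-∷-headDiffers x [] y (replicate b y) x≠y ⟩
      suc (changes R₂)                     ≡⟨ cong suc (changes-replicate y b) ⟩
      1                                    ∎
      where
      open ≡-Reasoning
      R₂ = replicate (suc b) y

    changes-frame : (x : Sym σ) (a : ℕ) (m : Sym σ) (ms : List (Sym σ)) (y : Sym σ) (b : ℕ) →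
                    HeadDiffers x (m ∷ ms ++ replicate (suc b) y) →
                    HeadDiffers y (reverse (m ∷ ms) ++ replicate (suc a) x) →
                    changes (frame x a (m ∷ ms) y b) ≡ 2 + changes (m ∷ ms)
    changes-frame x a m ms y b x≠m y≠ = begin
      changes (frame x a M y b)              ≡⟨ changes-reverse (frame x a M y b) ⟨
      changes (reverse (frame x a M y b))    ≡⟨ cong changes (reverse-frame x a M y b) ⟩
      changes (R₂ ++ reverse M ++ R₁)        ≡⟨ changes-replicate-++ y b (reverse M ++ R₁) ⟩
      changes (y ∷ reverse M ++ R₁)          ≡⟨ changes-∷-headDiffers y (reverse M) x (replicate a x) y≠ ⟩
      suc (changes (reverse M ++ R₁))        ≡⟨ cong (λ zs → suc (changes zs)) reverse-R₁M ⟨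
      suc (changes (reverse (R₁ ++ M)))      ≡⟨ cong suc (changes-reverse (R₁ ++ M)) ⟩
      suc (changes (R₁ ++ M))                ≡⟨ cong suc (changes-replicate-++ x a M) ⟩
      suc (changes (x ∷ M))                  ≡⟨ cong suc (changes-∷-headDiffers x [] m ms x≠m) ⟩
      2 + changes M                          ∎
      where
      open ≡-Reasoning
      M  = m ∷ ms
      R₁ = replicate (suc a) x
      R₂ = replicate (suc b) y
      reverse-R₁M : reverse (R₁ ++ M) ≡ reverse M ++ R₁
      reverse-R₁M = trans (List.reverse-++ R₁ M) (cong (reverse M ++_) (reverse-replicate x (suc a)))

    length-flashbackFuel-uniform : (f : ℕ) (x : Sym σ) (xs : List (Sym σ)) →
      (leadLen (x ∷ xs) ≡ᵇ length (x ∷ xs)) ≡ true → length (flashbackFuel (suc f) (x ∷ xs)) ≡ 1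
    length-flashbackFuel-uniform f x xs whole rewrite whole = refl

    length-flashbackFuel-last : (f : ℕ) (x : Sym σ) (xs : List (Sym σ)) →
      (leadLen (x ∷ xs) ≡ᵇ length (x ∷ xs)) ≡ false → middle (x ∷ xs) ≡ [] →
      length (flashbackFuel (suc f) (x ∷ xs)) ≡ 1
    length-flashbackFuel-last f x xs partial empty rewrite partial | empty = refl

    length-flashbackFuel-step : (f : ℕ) (x : Sym σ) (xs : List (Sym σ)) (m : Sym σ) (ms : List (Sym σ)) →
      (leadLen (x ∷ xs) ≡ᵇ length (x ∷ xs)) ≡ false → middle (x ∷ xs) ≡ m ∷ ms →
      length (flashbackFuel (suc f) (x ∷ xs)) ≡ suc (length (flashbackFuel f (m ∷ ms)))
    length-flashbackFuel-step f x xs m ms partial nonempty rewrite partial | nonempty = refl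

    length-flashbackFuel : (f : ℕ) {span : List (Sym σ)} → length span ≤ f → RunFrame span →
                           length (flashbackFuel (suc f) span) ≡ suc ⌊ changes span /2⌋
    length-flashbackFuel f _ (uniform x a) =
      trans (length-flashbackFuel-uniform f x (replicate a x) whole)
            (cong (λ c → suc ⌊ c /2⌋) (sym (changes-replicate x a)))
      where
      whole : (leadLen (replicate (suc a) x) ≡ᵇ length (replicate (suc a) x)) ≡ true
      whole = trans (cong₂ _≡ᵇ_ (cong suc (prefixLen-replicate x a)) (List.length-replicate (suc a)))
                    (≡ᵇ-refl (suc a))
    length-flashbackFuel f _ (framed x a [] y b x≠ y≠) =
      trans (length-flashbackFuel-last f x (replicate a x ++ replicate (suc b) y)
                                       (frame-not-uniform x a [] y b x≠) (middle-frame x a [] y b x≠ y≠))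
            (cong (λ c → suc ⌊ c /2⌋) (sym (changes-frame-[] x a y b x≠)))
    length-flashbackFuel (suc f) {span} (s≤s |span|≤f) (framed x a (m ∷ ms) y b x≠ y≠) = begin
      length (flashbackFuel (suc (suc f)) span)
        ≡⟨ length-flashbackFuel-step (suc f) x (replicate a x ++ M ++ replicate (suc b) y) m ms
             (frame-not-uniform x a M y b x≠) (middle-frame x a M y b x≠ y≠) ⟩
      suc (length (flashbackFuel (suc f) M))
        ≡⟨ cong suc (length-flashbackFuel f |M|≤f (runFrame m ms)) ⟩
      suc (suc ⌊ changes M /2⌋)
        ≡⟨ cong (λ c → suc ⌊ c /2⌋) (changes-frame x a m ms y b x≠ y≠) ⟨
      suc ⌊ changes span /2⌋ ∎
      where
      open ≡-Reasoning
      M = m ∷ ms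
      |M|≤f : length M ≤ f
      |M|≤f = ℕ.≤-trans (List.length-++-≤ˡ M)
                (ℕ.≤-trans (List.length-++-≤ʳ (M ++ replicate (suc b) y) {replicate a x}) |span|≤f)

    rle-∷ : (a : Fin σ) (t : List (Fin σ)) → ∃₂ λ m rest → rle (a ∷ t) ≡ (a , m) ∷ rest
    rle-∷ a t with rle t
    ... | []             = 1 , [] , refl
    ... | (b , m) ∷ rest with a Fin.≟ b
    ...   | yes refl = suc m , rest , refl
    ...   | no _     = 1 , (b , m) ∷ rest , refl

    runs-∷-∷ : (a b : Fin σ) (t : List (Fin σ)) → runs (a ∷ b ∷ t) ≡ differ (ch a) (ch b) + runs (b ∷ t)
    runs-∷-∷ a b t with rle-∷ b t
    ... | _ , _ , rle-bt rewrite rle-bt with does (a Fin.≟ b)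
    ...   | true  = refl
    ...   | false = refl

    runs-∷ : (a : Fin σ) (t : List (Fin σ)) → runs (a ∷ t) ≡ suc (changes (map ch (a ∷ t)))
    runs-∷ a []      = refl
    runs-∷ a (b ∷ t) = trans (runs-∷-∷ a b t) (trans (cong (differ (ch a) (ch b) +_) (runs-∷ b t)) (ℕ.+-suc _ _))

    changes-∷ʳ-dollar : (c : Fin σ) (s : List (Fin σ)) →
                        changes (ch c ∷ map ch s ++ [ dollar ]) ≡ suc (changes (map ch (c ∷ s)))
    changes-∷ʳ-dollar c []      = refl
    changes-∷ʳ-dollar c (d ∷ s) = trans (cong (differ (ch c) (ch d) +_) (changes-∷ʳ-dollar d s)) (ℕ.+-suc _ _)

    changes-hat : (s : List (Fin σ)) → changes (hat s) ≡ suc (runs s)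
    changes-hat []      = refl
    changes-hat (c ∷ s) = cong suc (trans (changes-∷ʳ-dollar c s) (sym (runs-∷ c s)))

    numTokens-runs : (s : List (Fin σ)) → numTokens s ≡ suc ⌈ runs s /2⌉
    numTokens-runs s =
      trans (length-flashbackFuel (length (hat s)) ℕ.≤-refl (runFrame at (map ch s ++ [ dollar ])))
            (cong (λ c → suc ⌊ c /2⌋) (changes-hat s))

  -- Counting strings by their runs

  ∑ : {A : Set} → List A → (A → ℕ) → ℕ
  ∑ xs f = sum (map f xs)

  syntax ∑ xs (λ x → e) = ∑[ x ∈ xs ] e

  𝟙 : Bool → ℕ
  𝟙 true  = 1
  𝟙 false = 0

  module _ {A : Set} where

    ∑-cong : {f g : A → ℕ} → (∀ x → f x ≡ g x) → (xs : List A) → ∑ xs f ≡ ∑ xs g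
    ∑-cong f≗g xs = cong sum (List.map-cong f≗g xs)

    ∑-+ : (f g : A → ℕ) (xs : List A) → ∑[ x ∈ xs ] (f x + g x) ≡ ∑ xs f + ∑ xs g
    ∑-+ f g []       = refl
    ∑-+ f g (x ∷ xs) = trans (cong (f x + g x +_) (∑-+ f g xs)) (interchange (f x) (g x) (∑ xs f) (∑ xs g))

    ∑-*ˡ : (c : ℕ) (f : A → ℕ) (xs : List A) → ∑[ x ∈ xs ] (c * f x) ≡ c * ∑ xs f
    ∑-*ˡ c f []       = sym (ℕ.*-zeroʳ c)
    ∑-*ˡ c f (x ∷ xs) = trans (cong (c * f x +_) (∑-*ˡ c f xs)) (sym (ℕ.*-distribˡ-+ c (f x) (∑ xs f)))

    ∑-const : (c : ℕ) (xs : List A) → ∑[ _ ∈ xs ] c ≡ length xs * c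
    ∑-const c []       = refl
    ∑-const c (x ∷ xs) = cong (c +_) (∑-const c xs)

    length-as-∑ : (xs : List A) → length xs ≡ ∑[ _ ∈ xs ] 1
    length-as-∑ xs = sym (trans (∑-const 1 xs) (ℕ.*-identityʳ (length xs)))

    length-filterᵇ : (P : A → Bool) (xs : List A) → length (filterᵇ P xs) ≡ ∑[ x ∈ xs ] 𝟙 (P x)
    length-filterᵇ P []       = refl
    length-filterᵇ P (x ∷ xs) with P x
    ... | true  = cong suc (length-filterᵇ P xs)
    ... | false = length-filterᵇ P xs

    ∑-++ : (xs ys : List A) (f : A → ℕ) → ∑ (xs ++ ys) f ≡ ∑ xs f + ∑ ys f
    ∑-++ xs ys f = trans (cong sum (List.map-++ f xs ys)) (sum-++ (map f xs) (map f ys))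

  ∑-swap : {A B : Set} (H : A → B → ℕ) (xs : List A) (ys : List B) →
           ∑[ x ∈ xs ] ∑[ y ∈ ys ] H x y ≡ ∑[ y ∈ ys ] ∑[ x ∈ xs ] H x y
  ∑-swap H []       ys = sym (trans (∑-const 0 ys) (ℕ.*-zeroʳ (length ys)))
  ∑-swap H (x ∷ xs) ys = trans (cong (∑ ys (H x) +_) (∑-swap H xs ys))
                               (sym (∑-+ (H x) (λ y → ∑[ x ∈ xs ] H x y) ys))

  ∑-concatMap-map : {A B : Set} (F : A → List B) (h : B → ℕ) (xs : List A) →
                    ∑ (concatMap F xs) h ≡ ∑[ x ∈ xs ] ∑ (F x) h
  ∑-concatMap-map F h []       = refl
  ∑-concatMap-map F h (x ∷ xs) =
    trans (∑-++ (F x) (concatMap F xs) h) (cong (∑ (F x) h +_) (∑-concatMap-map F h xs))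

  ∑-allStrings-suc : (σ n : ℕ) (F : List (Fin σ) → ℕ) →
                     ∑ (allStrings σ (suc n)) F ≡ ∑[ a ∈ allFin σ ] ∑[ s ∈ allStrings σ n ] F (a ∷ s)
  ∑-allStrings-suc σ n F =
    trans (∑-concatMap-map (λ a → map (a ∷_) (allStrings σ n)) F (allFin σ))
          (∑-cong (λ a → cong sum (sym (List.map-∘ (allStrings σ n)))) (allFin σ))

  ∑-allStrings-suc-cong : (σ n : ℕ) {F G : List (Fin σ) → ℕ} → (∀ b t → F (b ∷ t) ≡ G (b ∷ t)) →
                          ∑ (allStrings σ (suc n)) F ≡ ∑ (allStrings σ (suc n)) G
  ∑-allStrings-suc-cong σ n {F} {G} F≗G = begin
    ∑ (allStrings σ (suc n)) F
      ≡⟨ ∑-allStrings-suc σ n F ⟩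
    ∑[ a ∈ allFin σ ] ∑[ s ∈ allStrings σ n ] F (a ∷ s)
      ≡⟨ ∑-cong (λ a → ∑-cong (F≗G a) (allStrings σ n)) (allFin σ) ⟩
    ∑[ a ∈ allFin σ ] ∑[ s ∈ allStrings σ n ] G (a ∷ s)
      ≡⟨ ∑-allStrings-suc σ n G ⟨
    ∑ (allStrings σ (suc n)) G ∎
    where open ≡-Reasoning

  length-allStrings : (σ n : ℕ) → length (allStrings σ n) ≡ σ ^ n
  length-allStrings σ zero    = refl
  length-allStrings σ (suc n) = begin
    length (allStrings σ (suc n))
      ≡⟨ length-as-∑ (allStrings σ (suc n)) ⟩
    ∑[ _ ∈ allStrings σ (suc n) ] 1
      ≡⟨ ∑-allStrings-suc σ n (λ _ → 1) ⟩
    ∑[ _ ∈ allFin σ ] ∑[ _ ∈ allStrings σ n ] 1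
      ≡⟨ ∑-const _ (allFin σ) ⟩
    length (allFin σ) * ∑[ _ ∈ allStrings σ n ] 1
      ≡⟨ cong₂ _*_ (List.length-tabulate {n = σ} (λ a → a)) (sym (length-as-∑ (allStrings σ n))) ⟩
    σ * length (allStrings σ n)
      ≡⟨ cong (σ *_) (length-allStrings σ n) ⟩
    σ * σ ^ n ∎
    where open ≡-Reasoning

  sum-tabulate-≟ : (n : ℕ) (b : Fin (suc n)) (X Y : ℕ) →
                   sum (tabulate (λ a → if does (a Fin.≟ b) then X else Y)) ≡ X + n * Y
  sum-tabulate-≟ n       Fin.zero    X Y = cong (X +_) (sum-tabulate-const n)
    where
    sum-tabulate-const : (n : ℕ) → sum (tabulate {n = n} (λ _ → Y)) ≡ n * Y
    sum-tabulate-const zero    = refl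
    sum-tabulate-const (suc n) = cong (Y +_) (sum-tabulate-const n)
  sum-tabulate-≟ (suc n) (Fin.suc b) X Y = begin
    Y + sum (tabulate (λ a → if does (a Fin.≟ b) then X else Y))  ≡⟨ cong (Y +_) (sum-tabulate-≟ n b X Y) ⟩
    Y + (X + n * Y)                                               ≡⟨ ℕ.+-assoc Y X (n * Y) ⟨
    (Y + X) + n * Y                                               ≡⟨ cong (_+ n * Y) (ℕ.+-comm Y X) ⟩
    (X + Y) + n * Y                                               ≡⟨ ℕ.+-assoc X Y (n * Y) ⟩
    X + suc n * Y                                                 ∎
    where open ≡-Reasoning

  ∑-allFin-≟ : (n : ℕ) (b : Fin (suc n)) (X Y : ℕ) →
               ∑[ a ∈ allFin (suc n) ] (if does (a Fin.≟ b) then X else Y) ≡ X + n * Y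
  ∑-allFin-≟ n b X Y =
    trans (cong sum (List.map-tabulate (λ a → a) (λ a → if does (a Fin.≟ b) then X else Y)))
          (sum-tabulate-≟ n b X Y)

  parity : ℕ → ℕ
  parity zero          = 0
  parity (suc zero)    = 1
  parity (suc (suc n)) = parity n

  parity-+-parity-suc : (n : ℕ) → parity n + parity (suc n) ≡ 1
  parity-+-parity-suc zero          = refl
  parity-+-parity-suc (suc zero)    = refl
  parity-+-parity-suc (suc (suc n)) = parity-+-parity-suc n

  2*⌈n/2⌉≡n+parity : (n : ℕ) → 2 * ⌈ n /2⌉ ≡ n + parity n
  2*⌈n/2⌉≡n+parity zero          = refl
  2*⌈n/2⌉≡n+parity (suc zero)    = refl
  2*⌈n/2⌉≡n+parity (suc (suc n)) = trans (ℕ.*-suc 2 ⌈ n /2⌉) (cong (2 +_) (2*⌈n/2⌉≡n+parity n))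

  ∑-runs-singletons : (σ : ℕ) (G : ℕ → ℕ) → ∑[ s ∈ allStrings σ 1 ] G (runs s) ≡ σ * G 1
  ∑-runs-singletons σ G = begin
    ∑[ s ∈ allStrings σ 1 ] G (runs s)
      ≡⟨ ∑-allStrings-suc σ 0 (λ s → G (runs s)) ⟩
    ∑[ a ∈ allFin σ ] (G 1 + 0)
      ≡⟨ ∑-const (G 1 + 0) (allFin σ) ⟩
    length (allFin σ) * (G 1 + 0)
      ≡⟨ cong₂ _*_ (List.length-tabulate {n = σ} (λ a → a)) (ℕ.+-identityʳ (G 1)) ⟩
    σ * G 1 ∎
    where open ≡-Reasoning

  module _ (σ' : ℕ) where
    private
      σ : ℕ
      σ = suc σ'

    ∑-runs-prepend : (n : ℕ) (G : ℕ → ℕ) →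
      ∑[ s ∈ allStrings σ (2 + n) ] G (runs s)
        ≡ ∑[ s ∈ allStrings σ (suc n) ] (G (runs s) + σ' * G (suc (runs s)))
    ∑-runs-prepend n G = begin
      ∑[ s ∈ allStrings σ (2 + n) ] G (runs s)           ≡⟨ ∑-allStrings-suc σ (suc n) (λ s → G (runs s)) ⟩
      ∑[ a ∈ allFin σ ] ∑[ s ∈ T ] G (runs (a ∷ s))       ≡⟨ ∑-swap (λ a s → G (runs (a ∷ s))) (allFin σ) T ⟩
      ∑[ s ∈ T ] ∑[ a ∈ allFin σ ] G (runs (a ∷ s))       ≡⟨ ∑-allStrings-suc-cong σ n prepend ⟩
      ∑[ s ∈ T ] (G (runs s) + σ' * G (suc (runs s)))     ∎
      where
      open ≡-Reasoning
      T = allStrings σ (suc n)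
      -- a ∷ b ∷ t has as many runs as b ∷ t for a = b, and one more for the σ' other choices of a.
      prepend : ∀ b t → ∑[ a ∈ allFin σ ] G (runs (a ∷ b ∷ t)) ≡ G (runs (b ∷ t)) + σ' * G (suc (runs (b ∷ t)))
      prepend b t = trans (∑-cong (λ a → trans (cong G (runs-∷-∷ a b t))
                                               (if-float (λ d → G (d + runs (b ∷ t))) (does (a Fin.≟ b))))
                                  (allFin σ))
                          (∑-allFin-≟ σ' b _ _)

    ∑-runs : (m : ℕ) → ∑[ s ∈ allStrings σ (suc m) ] runs s ≡ σ ^ m * (σ + m * σ')
    ∑-runs zero    = trans (∑-runs-singletons σ (λ r → r))
                           (solve 1 (λ s → s :* con 1 := con 1 :* (s :+ con 0)) refl σ)
    ∑-runs (suc m) = begin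
      ∑[ s ∈ allStrings σ (2 + m) ] runs s
        ≡⟨ ∑-runs-prepend m (λ r → r) ⟩
      ∑[ s ∈ T ] (runs s + σ' * suc (runs s))
        ≡⟨ ∑-+ runs (λ s → σ' * suc (runs s)) T ⟩
      A + ∑[ s ∈ T ] (σ' * suc (runs s))
        ≡⟨ cong (A +_) (∑-*ˡ σ' (λ s → suc (runs s)) T) ⟩
      A + σ' * ∑[ s ∈ T ] (1 + runs s)
        ≡⟨ cong (λ n → A + σ' * n) (∑-+ (λ _ → 1) runs T) ⟩
      A + σ' * (∑[ _ ∈ T ] 1 + A)
        ≡⟨ cong (λ n → A + σ' * (n + A)) (sym (length-as-∑ T)) ⟩
      A + σ' * (length T + A)
        ≡⟨ cong₂ (λ a l → a + σ' * (l + a)) (∑-runs m) (length-allStrings σ (suc m)) ⟩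
      σ ^ m * (σ + m * σ') + σ' * (σ * σ ^ m + σ ^ m * (σ + m * σ'))
        ≡⟨ solve 3 (λ s' m P → P :* ((con 1 :+ s') :+ m :* s')
                                 :+ s' :* ((con 1 :+ s') :* P :+ P :* ((con 1 :+ s') :+ m :* s'))
                             := ((con 1 :+ s') :* P) :* ((con 1 :+ s') :+ (con 1 :+ m) :* s'))
                   refl σ' m (σ ^ m) ⟩
      σ ^ suc m * (σ + suc m * σ') ∎
      where
      open ≡-Reasoning
      T = allStrings σ (suc m)
      A = ∑[ s ∈ T ] runs s

    ∑-parity-runs-step : (m : ℕ) →
      let B = λ n → ∑[ s ∈ allStrings σ n ] parity (runs s) in
      B (2 + m) + σ' * B (suc m) ≡ B (suc m) + σ' * σ ^ suc m
    ∑-parity-runs-step m = begin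
      B₂ + σ' * B₁
        ≡⟨ cong (_+ σ' * B₁) (∑-runs-prepend m parity) ⟩
      ∑[ s ∈ T ] (parity (runs s) + σ' * parity (suc (runs s))) + σ' * B₁
        ≡⟨ cong (_+ σ' * B₁) (trans (∑-+ (λ s → parity (runs s)) _ T)
                                    (cong (B₁ +_) (∑-*ˡ σ' (λ s → parity (suc (runs s))) T))) ⟩
      B₁ + σ' * O + σ' * B₁
        ≡⟨ solve 3 (λ b s o → b :+ s :* o :+ s :* b := b :+ s :* (b :+ o)) refl B₁ σ' O ⟩
      B₁ + σ' * (B₁ + O)
        ≡⟨ cong (λ n → B₁ + σ' * n) (sym (∑-+ (λ s → parity (runs s)) (λ s → parity (suc (runs s))) T)) ⟩
      B₁ + σ' * ∑[ s ∈ T ] (parity (runs s) + parity (suc (runs s)))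
        ≡⟨ cong (λ n → B₁ + σ' * n)
                (trans (∑-cong (λ s → parity-+-parity-suc (runs s)) T) (sym (length-as-∑ T))) ⟩
      B₁ + σ' * length T
        ≡⟨ cong (λ n → B₁ + σ' * n) (length-allStrings σ (suc m)) ⟩
      B₁ + σ' * σ ^ suc m ∎
      where
      open ≡-Reasoning
      T = allStrings σ (suc m)
      B₁ = ∑[ s ∈ T ] parity (runs s)
      B₂ = ∑[ s ∈ allStrings σ (2 + m) ] parity (runs s)
      O = ∑[ s ∈ T ] parity (suc (runs s))

    count-runs : (m j : ℕ) → ∑[ s ∈ allStrings σ (suc m) ] 𝟙 ((runs s ∸ 1) ≡ᵇ j) ≡ σ * (σ' ^ j * (m C j))
    count-runs zero    zero    = ∑-runs-singletons σ (λ r → 𝟙 ((r ∸ 1) ≡ᵇ 0))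
    count-runs zero    (suc j) = trans (∑-runs-singletons σ (λ r → 𝟙 ((r ∸ 1) ≡ᵇ suc j)))
                                       (cong (σ *_) (sym (ℕ.*-zeroʳ (σ' ^ suc j))))
    count-runs (suc m) zero    = begin
      ∑[ s ∈ allStrings σ (2 + m) ] N₀ (runs s)                   ≡⟨ ∑-runs-prepend m N₀ ⟩
      ∑[ s ∈ T ] (N₀ (runs s) + σ' * N₀ (suc (runs s)))           ≡⟨ ∑-allStrings-suc-cong σ m N₀-prepend ⟩
      ∑[ s ∈ T ] N₀ (runs s)                                      ≡⟨ count-runs m 0 ⟩
      σ * (1 * 1)                                                 ∎
      where
      open ≡-Reasoning
      T = allStrings σ (suc m)
      N₀ = λ r → 𝟙 ((r ∸ 1) ≡ᵇ 0)
      N₀-prepend : ∀ b t → N₀ (runs (b ∷ t)) + σ' * N₀ (suc (runs (b ∷ t))) ≡ N₀ (runs (b ∷ t))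
      N₀-prepend b t rewrite runs-∷ b t =
        trans (cong (N₀ (suc (changes (map ch (b ∷ t)))) +_) (ℕ.*-zeroʳ σ')) (ℕ.+-identityʳ _)
    count-runs (suc m) (suc j) = begin
      ∑[ s ∈ allStrings σ (2 + m) ] N (suc j) (runs s)
        ≡⟨ ∑-runs-prepend m (N (suc j)) ⟩
      ∑[ s ∈ T ] (N (suc j) (runs s) + σ' * N (suc j) (suc (runs s)))
        ≡⟨ ∑-allStrings-suc-cong σ m N-prepend ⟩
      ∑[ s ∈ T ] (N (suc j) (runs s) + σ' * N j (runs s))
        ≡⟨ ∑-+ (λ s → N (suc j) (runs s)) (λ s → σ' * N j (runs s)) T ⟩
      ∑[ s ∈ T ] N (suc j) (runs s) + ∑[ s ∈ T ] (σ' * N j (runs s))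
        ≡⟨ cong (∑[ s ∈ T ] N (suc j) (runs s) +_) (∑-*ˡ σ' (λ s → N j (runs s)) T) ⟩
      ∑[ s ∈ T ] N (suc j) (runs s) + σ' * ∑[ s ∈ T ] N j (runs s)
        ≡⟨ cong₂ (λ x y → x + σ' * y) (count-runs m (suc j)) (count-runs m j) ⟩
      σ * (σ' ^ suc j * (m C suc j)) + σ' * (σ * (σ' ^ j * (m C j)))
        ≡⟨ solve 4 (λ s P c₁ c₂ → (con 1 :+ s) :* ((s :* P) :* c₂) :+ s :* ((con 1 :+ s) :* (P :* c₁))
                                := (con 1 :+ s) :* ((s :* P) :* (c₁ :+ c₂)))
                   refl σ' (σ' ^ j) (m C j) (m C suc j) ⟩
      σ * (σ' ^ suc j * (m C j + m C suc j))
        ≡⟨ cong (λ c → σ * (σ' ^ suc j * c)) (nCk+nC[k+1]≡[n+1]C[k+1] m j) ⟩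
      σ * (σ' ^ suc j * (suc m C suc j)) ∎
      where
      open ≡-Reasoning
      T = allStrings σ (suc m)
      N = λ j r → 𝟙 ((r ∸ 1) ≡ᵇ j)
      N-prepend : ∀ b t → N (suc j) (runs (b ∷ t)) + σ' * N (suc j) (suc (runs (b ∷ t)))
                    ≡ N (suc j) (runs (b ∷ t)) + σ' * N j (runs (b ∷ t))
      N-prepend b t rewrite runs-∷ b t = refl

  ∑-numTokens : (σ n : ℕ) →
    2 * ∑[ s ∈ allStrings σ n ] numTokens s
      ≡ 2 * σ ^ n + ∑[ s ∈ allStrings σ n ] runs s + ∑[ s ∈ allStrings σ n ] parity (runs s)
  ∑-numTokens σ n = begin
    2 * ∑[ s ∈ T ] numTokens s
      ≡⟨ ∑-*ˡ 2 numTokens T ⟨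
    ∑[ s ∈ T ] (2 * numTokens s)
      ≡⟨ ∑-cong twice-numTokens T ⟩
    ∑[ s ∈ T ] (2 + runs s + parity (runs s))
      ≡⟨ ∑-+ (λ s → 2 + runs s) (λ s → parity (runs s)) T ⟩
    ∑[ s ∈ T ] (2 + runs s) + ∑[ s ∈ T ] parity (runs s)
      ≡⟨ cong (_+ ∑[ s ∈ T ] parity (runs s)) (∑-+ (λ _ → 2) runs T) ⟩
    ∑[ _ ∈ T ] 2 + ∑[ s ∈ T ] runs s + ∑[ s ∈ T ] parity (runs s)
      ≡⟨ cong (λ n → n + ∑[ s ∈ T ] runs s + ∑[ s ∈ T ] parity (runs s))
              (trans (∑-const 2 T) (trans (ℕ.*-comm (length T) 2) (cong (2 *_) (length-allStrings σ n)))) ⟩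
    2 * σ ^ n + ∑[ s ∈ T ] runs s + ∑[ s ∈ T ] parity (runs s) ∎
    where
    open ≡-Reasoning
    T = allStrings σ n
    twice-numTokens : ∀ s → 2 * numTokens s ≡ 2 + runs s + parity (runs s)
    twice-numTokens s = begin
      2 * numTokens s                  ≡⟨ cong (2 *_) (numTokens-runs s) ⟩
      2 * suc ⌈ runs s /2⌉             ≡⟨ ℕ.*-suc 2 ⌈ runs s /2⌉ ⟩
      2 + 2 * ⌈ runs s /2⌉             ≡⟨ cong (2 +_) (2*⌈n/2⌉≡n+parity (runs s)) ⟩
      2 + (runs s + parity (runs s))   ≡⟨ ℕ.+-assoc 2 (runs s) _ ⟨
      2 + runs s + parity (runs s)     ∎

-- Rational arithmetic

module _ where
  open import Data.Integer using (ℤ; +_; _⊖_)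
  open import Data.Rational using (ℚ; 0ℚ; 1ℚ; _+_; _*_; _-_; -_; _/_; ∣_∣; _≤_; fromℚᵘ; toℚᵘ)
  open import Data.Rational.Properties
  open import Data.Rational.Unnormalised as ℚᵘ using (ℚᵘ; mkℚᵘ; *≡*; *≤*)
  import Data.Rational.Unnormalised.Properties as ℚᵘ
  open import Data.Rational.Solver using (module +-*-Solver)
  open +-*-Solver using (solve; _:=_; _:+_; _:*_; _:-_; con)

  fromℚᵘ-homo-+ : (p q : ℚᵘ) → fromℚᵘ (p ℚᵘ.+ q) ≡ fromℚᵘ p + fromℚᵘ q
  fromℚᵘ-homo-+ p q = toℚᵘ-injective (ℚᵘ.≃-trans (toℚᵘ-fromℚᵘ (p ℚᵘ.+ q))
    (ℚᵘ.≃-sym (ℚᵘ.≃-trans (toℚᵘ-homo-+ (fromℚᵘ p) (fromℚᵘ q)) (ℚᵘ.+-cong (toℚᵘ-fromℚᵘ p) (toℚᵘ-fromℚᵘ q)))))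

  fromℚᵘ-homo-* : (p q : ℚᵘ) → fromℚᵘ (p ℚᵘ.* q) ≡ fromℚᵘ p * fromℚᵘ q
  fromℚᵘ-homo-* p q = toℚᵘ-injective (ℚᵘ.≃-trans (toℚᵘ-fromℚᵘ (p ℚᵘ.* q))
    (ℚᵘ.≃-sym (ℚᵘ.≃-trans (toℚᵘ-homo-* (fromℚᵘ p) (fromℚᵘ q)) (ℚᵘ.*-cong (toℚᵘ-fromℚᵘ p) (toℚᵘ-fromℚᵘ q)))))

  fromℚᵘ-homo‿- : (p : ℚᵘ) → fromℚᵘ (ℚᵘ.- p) ≡ - fromℚᵘ p
  fromℚᵘ-homo‿- p = toℚᵘ-injective (ℚᵘ.≃-trans (toℚᵘ-fromℚᵘ (ℚᵘ.- p))
    (ℚᵘ.≃-sym (ℚᵘ.≃-trans (toℚᵘ-homo‿- (fromℚᵘ p)) (ℚᵘ.-‿cong (toℚᵘ-fromℚᵘ p)))))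

  ℤ→ℚ : ℤ → ℚ
  ℤ→ℚ i = i / 1

  ℤ→ℚ-homo-+ : (i j : ℤ) → ℤ→ℚ (i ℤ.+ j) ≡ ℤ→ℚ i + ℤ→ℚ j
  ℤ→ℚ-homo-+ i j = trans (fromℚᵘ-cong {mkℚᵘ (i ℤ.+ j) 0} {mkℚᵘ i 0 ℚᵘ.+ mkℚᵘ j 0} (*≡* numerators≡))
                         (fromℚᵘ-homo-+ (mkℚᵘ i 0) (mkℚᵘ j 0))
    where
    numerators≡ : (i ℤ.+ j) ℤ.* + 1 ≡ (i ℤ.* + 1 ℤ.+ j ℤ.* + 1) ℤ.* + 1
    numerators≡ = cong (ℤ._* + 1) (sym (cong₂ ℤ._+_ (ℤ.*-identityʳ i) (ℤ.*-identityʳ j)))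

  ℤ→ℚ-homo-* : (i j : ℤ) → ℤ→ℚ (i ℤ.* j) ≡ ℤ→ℚ i * ℤ→ℚ j
  ℤ→ℚ-homo-* i j = trans (fromℚᵘ-cong {mkℚᵘ (i ℤ.* j) 0} {mkℚᵘ i 0 ℚᵘ.* mkℚᵘ j 0} (*≡* refl))
                         (fromℚᵘ-homo-* (mkℚᵘ i 0) (mkℚᵘ j 0))

  ℤ→ℚ-⊖ : (m n : ℕ) → ℤ→ℚ (m ⊖ n) ≡ ℕ→ℚ m - ℕ→ℚ n
  ℤ→ℚ-⊖ m n = trans (cong ℤ→ℚ (sym (ℤ.m-n≡m⊖n m n)))
                    (trans (ℤ→ℚ-homo-+ (+ m) (ℤ.- (+ n))) (cong (λ x → ℕ→ℚ m + x) (fromℚᵘ-homo‿- (mkℚᵘ (+ n) 0))))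

  ℕ→ℚ-homo-+ : (m n : ℕ) → ℕ→ℚ (m ℕ.+ n) ≡ ℕ→ℚ m + ℕ→ℚ n
  ℕ→ℚ-homo-+ m n = trans (cong ℤ→ℚ (ℤ.pos-+ m n)) (ℤ→ℚ-homo-+ (+ m) (+ n))

  ℕ→ℚ-homo-* : (m n : ℕ) → ℕ→ℚ (m ℕ.* n) ≡ ℕ→ℚ m * ℕ→ℚ n
  ℕ→ℚ-homo-* m n = trans (cong ℤ→ℚ (ℤ.pos-* m n)) (ℤ→ℚ-homo-* (+ m) (+ n))

  ℕ→ℚ-homo-^ : (m k : ℕ) → ℕ→ℚ (m ℕ.^ k) ≡ ℕ→ℚ m ^ℚ k
  ℕ→ℚ-homo-^ m zero    = refl
  ℕ→ℚ-homo-^ m (suc k) = trans (ℕ→ℚ-homo-* m (m ℕ.^ k)) (cong (ℕ→ℚ m *_) (ℕ→ℚ-homo-^ m k))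

  /-as-* : (i : ℤ) (d : ℕ) → i / suc d ≡ ℤ→ℚ i * ((+ 1) / suc d)
  /-as-* i d = trans (fromℚᵘ-cong {mkℚᵘ i d} {mkℚᵘ i 0 ℚᵘ.* mkℚᵘ (+ 1) d} (*≡* i↧≡))
                     (fromℚᵘ-homo-* (mkℚᵘ i 0) (mkℚᵘ (+ 1) d))
    where
    i↧≡ : i ℤ.* (+ suc (d ℕ.+ 0)) ≡ (i ℤ.* (+ 1)) ℤ.* (+ suc d)
    i↧≡ rewrite ℕ.+-identityʳ d = cong (ℤ._* + suc d) (sym (ℤ.*-identityʳ i))

  ℕ→ℚ-*-recip : (d : ℕ) → ℕ→ℚ (suc d) * ((+ 1) / suc d) ≡ 1ℚ
  ℕ→ℚ-*-recip d = trans (sym (/-as-* (+ suc d) d))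
                        (fromℚᵘ-cong {mkℚᵘ (+ suc d) d} {mkℚᵘ (+ 1) 0} (*≡* (ℤ.*-comm (+ suc d) (+ 1))))

  /ℕ-unique : (a : ℕ) {L : ℕ} (Y : ℚ) → 0 ℕ.< L → Y * ℕ→ℚ L ≡ ℕ→ℚ a → (+ a) /ℕ L ≡ Y
  /ℕ-unique a {suc d} Y _ Y*L≡a = begin
    (+ a) / suc d                           ≡⟨ /-as-* (+ a) d ⟩
    ℕ→ℚ a * w                               ≡⟨ cong (_* w) Y*L≡a ⟨
    Y * ℕ→ℚ (suc d) * w                     ≡⟨ *-assoc Y (ℕ→ℚ (suc d)) w ⟩
    Y * (ℕ→ℚ (suc d) * w)                   ≡⟨ cong (Y *_) (ℕ→ℚ-*-recip d) ⟩
    Y * 1ℚ                                  ≡⟨ *-identityʳ Y ⟩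
    Y                                       ∎
    where
    open ≡-Reasoning
    w = (+ 1) / suc d

  ^ℚ-distribʳ-* : (x y : ℚ) (k : ℕ) → (x * y) ^ℚ k ≡ x ^ℚ k * y ^ℚ k
  ^ℚ-distribʳ-* x y zero    = refl
  ^ℚ-distribʳ-* x y (suc k) =
    trans (cong (x * y *_) (^ℚ-distribʳ-* x y k))
          (solve 4 (λ x y a b → x :* y :* (a :* b) := x :* a :* (y :* b)) refl x y (x ^ℚ k) (y ^ℚ k))

  1^ℚn≡1 : (k : ℕ) → 1ℚ ^ℚ k ≡ 1ℚ
  1^ℚn≡1 zero    = refl
  1^ℚn≡1 (suc k) = trans (*-identityˡ (1ℚ ^ℚ k)) (1^ℚn≡1 k)

  ^ℚ-distribˡ-+-* : (x : ℚ) (a b : ℕ) → x ^ℚ (a ℕ.+ b) ≡ x ^ℚ a * x ^ℚ b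
  ^ℚ-distribˡ-+-* x zero    b = sym (*-identityˡ (x ^ℚ b))
  ^ℚ-distribˡ-+-* x (suc a) b = trans (cong (x *_) (^ℚ-distribˡ-+-* x a b)) (sym (*-assoc x (x ^ℚ a) (x ^ℚ b)))

  ∣/suc∣≤1 : (i : ℤ) (d : ℕ) → ℤ.∣ i ∣ ℕ.≤ suc d → ∣ i / suc d ∣ ≤ 1ℚ
  ∣/suc∣≤1 i d ∣i∣≤d+1 = toℚᵘ-cancel-≤ (ℚᵘ.≤-respˡ-≃ (ℚᵘ.≃-sym ∣i/d∣≃) (*≤* ∣i∣*1≤1*[d+1]))
    where
    ∣i∣*1≤1*[d+1] : + ℤ.∣ i ∣ ℤ.* + 1 ℤ.≤ + 1 ℤ.* + suc d
    ∣i∣*1≤1*[d+1] = subst₂ ℤ._≤_ (sym (ℤ.*-identityʳ (+ ℤ.∣ i ∣))) (sym (ℤ.*-identityˡ (+ suc d))) (ℤ.+≤+ ∣i∣≤d+1)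
    ∣i/d∣≃ : toℚᵘ ∣ i / suc d ∣ ℚᵘ.≃ mkℚᵘ (+ ℤ.∣ i ∣) d
    ∣i/d∣≃ = ℚᵘ.≃-trans (toℚᵘ-homo-∣-∣ (i / suc d)) (ℚᵘ.∣-∣-cong (toℚᵘ-fromℚᵘ (mkℚᵘ i d)))

  ∣^ℚ∣≤1 : (x : ℚ) (k : ℕ) → ∣ x ∣ ≤ 1ℚ → ∣ x ^ℚ k ∣ ≤ 1ℚ
  ∣^ℚ∣≤1 x zero    _      = ≤-refl
  ∣^ℚ∣≤1 x (suc k) ∣x∣≤1 = begin
    ∣ x * x ^ℚ k ∣          ≡⟨ ∣p*q∣≡∣p∣*∣q∣ x (x ^ℚ k) ⟩
    ∣ x ∣ * ∣ x ^ℚ k ∣      ≤⟨ *-monoʳ-≤-nonNeg ∣ x ^ℚ k ∣ {{∣-∣-nonNeg (x ^ℚ k)}} ∣x∣≤1 ⟩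
    1ℚ * ∣ x ^ℚ k ∣         ≤⟨ *-monoˡ-≤-nonNeg 1ℚ (∣^ℚ∣≤1 x k ∣x∣≤1) ⟩
    1ℚ                      ∎
    where open ≤-Reasoning

  ∣2⊖[1+n]∣≤1+n : (n : ℕ) → ℤ.∣ 2 ⊖ suc n ∣ ℕ.≤ suc n
  ∣2⊖[1+n]∣≤1+n zero    = ℕ.s≤s ℕ.z≤n
  ∣2⊖[1+n]∣≤1+n (suc n) = ℕ.≤-trans (ℕ.≤-reflexive (ℤ.∣⊖∣-≤ (ℕ.s≤s (ℕ.s≤s ℕ.z≤n)))) (ℕ.m∸n≤m (2 ℕ.+ n) 2)

  ½ ¼ : ℚ
  ½ = (+ 1) /ℕ 2
  ¼ = (+ 1) /ℕ 4

  -- The law of r(s) and the expectation of k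

  -- σ = suc σ' makes σ ∸ 1 reduce to σ' and keeps /ℕ σ away from its junk value at 0.
  -- All denominators are cleared with u * s ≡ 1.
  module _ (σ' : ℕ) where
    private
      σ : ℕ
      σ = suc σ'
      t s u p q : ℚ
      t = ℕ→ℚ σ'
      s = 1ℚ + t
      u = (+ 1) /ℕ σ
      p = (+ (σ ∸ 1)) /ℕ σ
      q = (2 ⊖ σ) /ℕ σ

    ℕ→ℚ-σ : ℕ→ℚ σ ≡ s
    ℕ→ℚ-σ = ℕ→ℚ-homo-+ 1 σ'

    ℕ→ℚ-σ^ : (n : ℕ) → ℕ→ℚ (σ ℕ.^ n) ≡ s ^ℚ n
    ℕ→ℚ-σ^ n = trans (ℕ→ℚ-homo-^ σ n) (cong (_^ℚ n) ℕ→ℚ-σ)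

    u*s≡1 : u * s ≡ 1ℚ
    u*s≡1 = trans (*-comm u s) (trans (cong (_* u) (sym ℕ→ℚ-σ)) (ℕ→ℚ-*-recip σ'))

    p≡t*u : p ≡ t * u
    p≡t*u = /-as-* (+ σ') σ'

    p*s≡t : p * s ≡ t
    p*s≡t = begin
      p * s          ≡⟨ cong (_* s) p≡t*u ⟩
      t * u * s      ≡⟨ solve 3 (λ t u s → t :* u :* s := t :* (u :* s)) refl t u s ⟩
      t * (u * s)    ≡⟨ cong (t *_) u*s≡1 ⟩
      t * 1ℚ         ≡⟨ *-identityʳ t ⟩
      t              ∎
      where open ≡-Reasoning

    1-p≡u : 1ℚ - p ≡ u
    1-p≡u = begin
      1ℚ - p               ≡⟨ cong₂ _-_ (sym u*s≡1) p≡t*u ⟩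
      u * (1ℚ + t) - t * u ≡⟨ solve 2 (λ u t → u :* (con 1ℚ :+ t) :- t :* u := u) refl u t ⟩
      u                    ∎
      where open ≡-Reasoning

    q*s≡1-t : q * s ≡ 1ℚ - t
    q*s≡1-t = begin
      q * s
        ≡⟨ cong (_* s) (/-as-* (2 ⊖ σ) σ') ⟩
      ℤ→ℚ (2 ⊖ σ) * u * s
        ≡⟨ cong (λ x → x * u * s) (trans (ℤ→ℚ-⊖ 2 σ) (cong (λ x → ℕ→ℚ 2 - x) ℕ→ℚ-σ)) ⟩
      (ℕ→ℚ 2 - (1ℚ + t)) * u * s
        ≡⟨ solve 3 (λ t u s → (con (ℕ→ℚ 2) :- (con 1ℚ :+ t)) :* u :* s := (con 1ℚ :- t) :* (u :* s)) refl t u s ⟩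
      (1ℚ - t) * (u * s)
        ≡⟨ cong ((1ℚ - t) *_) u*s≡1 ⟩
      (1ℚ - t) * 1ℚ
        ≡⟨ *-identityʳ (1ℚ - t) ⟩
      1ℚ - t ∎
      where open ≡-Reasoning

    ^ℚ-*u-cancel : (x : ℚ) (k : ℕ) → (x * u) ^ℚ k * s ^ℚ k ≡ x ^ℚ k
    ^ℚ-*u-cancel x k = begin
      (x * u) ^ℚ k * s ^ℚ k    ≡⟨ ^ℚ-distribʳ-* (x * u) s k ⟨
      (x * u * s) ^ℚ k         ≡⟨ cong (_^ℚ k) (solve 3 (λ x u s → x :* u :* s := x :* (u :* s)) refl x u s) ⟩
      (x * (u * s)) ^ℚ k       ≡⟨ cong (λ y → (x * y) ^ℚ k) u*s≡1 ⟩
      (x * 1ℚ) ^ℚ k            ≡⟨ cong (_^ℚ k) (*-identityʳ x) ⟩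
      x ^ℚ k                   ∎
      where open ≡-Reasoning

    length-allStrings-ℚ : (n : ℕ) → ℕ→ℚ (length (allStrings σ n)) ≡ s ^ℚ n
    length-allStrings-ℚ n = trans (cong ℕ→ℚ (length-allStrings σ n)) (ℕ→ℚ-σ^ n)

    length-allStrings-pos : (n : ℕ) → 0 ℕ.< length (allStrings σ n)
    length-allStrings-pos n = subst (0 ℕ.<_) (sym (length-allStrings σ n)) (ℕ.m^n>0 σ n)

    binomial-weight : (j d : ℕ) → p ^ℚ j * (1ℚ - p) ^ℚ d * s ^ℚ (j ℕ.+ d) ≡ t ^ℚ j
    binomial-weight j d = begin
      p ^ℚ j * (1ℚ - p) ^ℚ d * s ^ℚ (j ℕ.+ d)
        ≡⟨ cong₂ (λ x y → x ^ℚ j * y ^ℚ d * s ^ℚ (j ℕ.+ d)) p≡t*u 1-p≡u ⟩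
      (t * u) ^ℚ j * u ^ℚ d * s ^ℚ (j ℕ.+ d)
        ≡⟨ cong ((t * u) ^ℚ j * u ^ℚ d *_) (^ℚ-distribˡ-+-* s j d) ⟩
      (t * u) ^ℚ j * u ^ℚ d * (s ^ℚ j * s ^ℚ d)
        ≡⟨ solve 4 (λ a b c e → a :* b :* (c :* e) := a :* c :* (b :* e))
                   refl ((t * u) ^ℚ j) (u ^ℚ d) (s ^ℚ j) (s ^ℚ d) ⟩
      (t * u) ^ℚ j * s ^ℚ j * (u ^ℚ d * s ^ℚ d)
        ≡⟨ cong₂ _*_ (^ℚ-*u-cancel t j) u^d*s^d≡1 ⟩
      t ^ℚ j * 1ℚ
        ≡⟨ *-identityʳ (t ^ℚ j) ⟩
      t ^ℚ j ∎
      where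
      open ≡-Reasoning
      u^d*s^d≡1 : u ^ℚ d * s ^ℚ d ≡ 1ℚ
      u^d*s^d≡1 = trans (cong (λ y → y ^ℚ d * s ^ℚ d) (sym (*-identityˡ u)))
                        (trans (^ℚ-*u-cancel 1ℚ d) (1^ℚn≡1 d))

    binomialPMF-scaled : (m j : ℕ) → binomialPMF m p j * s ^ℚ suc m ≡ s * (t ^ℚ j * ℕ→ℚ (m C j))
    binomialPMF-scaled m j with ℕ.≤-<-connex j m
    ... | inj₂ m<j rewrite k>n⇒nCk≡0 m<j =
      solve 4 (λ a b c e → con 0ℚ :* a :* b := c :* (e :* con 0ℚ))
              refl (p ^ℚ j * (1ℚ - p) ^ℚ (m ∸ j)) (s ^ℚ suc m) s (t ^ℚ j)
    ... | inj₁ j≤m = scaled (m ∸ j) (ℕ.m+[n∸m]≡n j≤m)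
      where
      open ≡-Reasoning
      scaled : (d : ℕ) → j ℕ.+ d ≡ m → binomialPMF m p j * s ^ℚ suc m ≡ s * (t ^ℚ j * ℕ→ℚ (m C j))
      scaled d refl = begin
        Ĉ * (p ^ℚ j * (1ℚ - p) ^ℚ (j ℕ.+ d ∸ j)) * (s * s ^ℚ (j ℕ.+ d))
          ≡⟨ cong (λ e → Ĉ * (p ^ℚ j * (1ℚ - p) ^ℚ e) * (s * s ^ℚ (j ℕ.+ d))) (ℕ.m+n∸m≡n j d) ⟩
        Ĉ * (p ^ℚ j * (1ℚ - p) ^ℚ d) * (s * s ^ℚ (j ℕ.+ d))
          ≡⟨ solve 5 (λ c a b s x → c :* (a :* b) :* (s :* x) := s :* (a :* b :* x :* c))
                     refl Ĉ (p ^ℚ j) ((1ℚ - p) ^ℚ d) s (s ^ℚ (j ℕ.+ d)) ⟩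
        s * (p ^ℚ j * (1ℚ - p) ^ℚ d * s ^ℚ (j ℕ.+ d) * Ĉ)
          ≡⟨ cong (λ w → s * (w * Ĉ)) (binomial-weight j d) ⟩
        s * (t ^ℚ j * Ĉ) ∎
        where
        Ĉ = ℕ→ℚ ((j ℕ.+ d) C j)

    runs-distribution : (m j : ℕ) → prob σ (suc m) (λ x → (runs x ∸ 1) ≡ᵇ j) ≡ binomialPMF m p j
    runs-distribution m j =
      /ℕ-unique (length (filterᵇ P T)) (binomialPMF m p j) (length-allStrings-pos (suc m)) (begin
        binomialPMF m p j * ℕ→ℚ (length T)
          ≡⟨ cong (binomialPMF m p j *_) (length-allStrings-ℚ (suc m)) ⟩
        binomialPMF m p j * s ^ℚ suc m
          ≡⟨ binomialPMF-scaled m j ⟩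
        s * (t ^ℚ j * ℕ→ℚ (m C j))
          ≡⟨ count-ℚ ⟨
        ℕ→ℚ (length (filterᵇ P T)) ∎)
      where
      open ≡-Reasoning
      T = allStrings σ (suc m)
      P = λ x → (runs x ∸ 1) ≡ᵇ j
      count-ℚ : ℕ→ℚ (length (filterᵇ P T)) ≡ s * (t ^ℚ j * ℕ→ℚ (m C j))
      count-ℚ = begin
        ℕ→ℚ (length (filterᵇ P T))
          ≡⟨ cong ℕ→ℚ (trans (length-filterᵇ P T) (count-runs σ' m j)) ⟩
        ℕ→ℚ (σ ℕ.* (σ' ℕ.^ j ℕ.* (m C j)))
          ≡⟨ ℕ→ℚ-homo-* σ (σ' ℕ.^ j ℕ.* (m C j)) ⟩
        ℕ→ℚ σ * ℕ→ℚ (σ' ℕ.^ j ℕ.* (m C j))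
          ≡⟨ cong₂ _*_ ℕ→ℚ-σ (ℕ→ℚ-homo-* (σ' ℕ.^ j) (m C j)) ⟩
        s * (ℕ→ℚ (σ' ℕ.^ j) * ℕ→ℚ (m C j))
          ≡⟨ cong (λ x → s * (x * ℕ→ℚ (m C j))) (ℕ→ℚ-homo-^ σ' j) ⟩
        s * (t ^ℚ j * ℕ→ℚ (m C j)) ∎

    ∑-runs-ℚ : (m : ℕ) → ℕ→ℚ (∑[ x ∈ allStrings σ (suc m) ] runs x) ≡ (1ℚ + ℕ→ℚ m * p) * s ^ℚ suc m
    ∑-runs-ℚ m = begin
      ℕ→ℚ (∑[ x ∈ allStrings σ (suc m) ] runs x)
        ≡⟨ cong ℕ→ℚ (∑-runs σ' m) ⟩
      ℕ→ℚ (σ ℕ.^ m ℕ.* (σ ℕ.+ m ℕ.* σ'))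
        ≡⟨ ℕ→ℚ-homo-* (σ ℕ.^ m) (σ ℕ.+ m ℕ.* σ') ⟩
      ℕ→ℚ (σ ℕ.^ m) * ℕ→ℚ (σ ℕ.+ m ℕ.* σ')
        ≡⟨ cong₂ _*_ (ℕ→ℚ-σ^ m) (trans (ℕ→ℚ-homo-+ σ (m ℕ.* σ')) (cong₂ _+_ ℕ→ℚ-σ (ℕ→ℚ-homo-* m σ'))) ⟩
      s ^ℚ m * (s + m̂ * t)
        ≡⟨ cong (λ x → s ^ℚ m * (s + m̂ * x)) p*s≡t ⟨
      s ^ℚ m * (s + m̂ * (p * s))
        ≡⟨ solve 4 (λ S t m̂ p → S :* ((con 1ℚ :+ t) :+ m̂ :* (p :* (con 1ℚ :+ t)))
                         := (con 1ℚ :+ m̂ :* p) :* ((con 1ℚ :+ t) :* S)) refl (s ^ℚ m) t m̂ p ⟩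
      (1ℚ + m̂ * p) * s ^ℚ suc m ∎
      where
      open ≡-Reasoning
      m̂ = ℕ→ℚ m

    ∑-parity-runs-ℚ : (m : ℕ) →
      ℕ→ℚ (∑[ x ∈ allStrings σ (suc m) ] parity (runs x)) ≡ (1ℚ + q ^ℚ m) * ½ * s ^ℚ suc m
    ∑-parity-runs-ℚ zero    = begin
      ℕ→ℚ (∑[ x ∈ allStrings σ 1 ] parity (runs x))
        ≡⟨ cong ℕ→ℚ (trans (∑-runs-singletons σ parity) (ℕ.*-identityʳ σ)) ⟩
      ℕ→ℚ σ
        ≡⟨ ℕ→ℚ-σ ⟩
      1ℚ + t
        ≡⟨ solve 1 (λ t → con 1ℚ :+ t := (con 1ℚ :+ con 1ℚ) :* con ½ :* ((con 1ℚ :+ t) :* con 1ℚ)) refl t ⟩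
      (1ℚ + 1ℚ) * ½ * (s * 1ℚ) ∎
      where open ≡-Reasoning
    ∑-parity-runs-ℚ (suc m) = begin
      b₂
        ≡⟨ solve 3 (λ b₂ t b₁ → b₂ := b₂ :+ t :* b₁ :- t :* b₁) refl b₂ t b₁ ⟩
      b₂ + t * b₁ - t * b₁
        ≡⟨ cong (_- t * b₁) recurrence ⟩
      b₁ + t * X - t * b₁
        ≡⟨ cong (λ b → b + t * X - t * b) (∑-parity-runs-ℚ m) ⟩
      (1ℚ + W) * ½ * X + t * X - t * ((1ℚ + W) * ½ * X)
        ≡⟨ solve 3 (λ W t X → (con 1ℚ :+ W) :* con ½ :* X :+ t :* X :- t :* ((con 1ℚ :+ W) :* con ½ :* X)
                            := con ½ :* ((con 1ℚ :+ t) :* X) :+ con ½ :* W :* ((con 1ℚ :- t) :* X)) refl W t X ⟩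
      ½ * (s * X) + ½ * W * ((1ℚ - t) * X)
        ≡⟨ cong (λ y → ½ * (s * X) + ½ * W * (y * X)) q*s≡1-t ⟨
      ½ * (s * X) + ½ * W * (q * s * X)
        ≡⟨ solve 4 (λ q W s X → con ½ :* (s :* X) :+ con ½ :* W :* (q :* s :* X)
                           := (con 1ℚ :+ q :* W) :* con ½ :* (s :* X)) refl q W s X ⟩
      (1ℚ + q ^ℚ suc m) * ½ * s ^ℚ (2 ℕ.+ m) ∎
      where
      open ≡-Reasoning
      B : ℕ → ℕ
      B n = ∑[ x ∈ allStrings σ n ] parity (runs x)
      b₁ b₂ X W : ℚ
      b₁ = ℕ→ℚ (B (suc m))
      b₂ = ℕ→ℚ (B (2 ℕ.+ m))
      X = s ^ℚ suc m
      W = q ^ℚ m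
      recurrence : b₂ + t * b₁ ≡ b₁ + t * X
      recurrence = begin
        b₂ + t * b₁
          ≡⟨ trans (ℕ→ℚ-homo-+ (B (2 ℕ.+ m)) _) (cong (λ x → b₂ + x) (ℕ→ℚ-homo-* σ' (B (suc m)))) ⟨
        ℕ→ℚ (B (2 ℕ.+ m) ℕ.+ σ' ℕ.* B (suc m))
          ≡⟨ cong ℕ→ℚ (∑-parity-runs-step σ' m) ⟩
        ℕ→ℚ (B (suc m) ℕ.+ σ' ℕ.* σ ℕ.^ suc m)
          ≡⟨ ℕ→ℚ-homo-+ (B (suc m)) _ ⟩
        b₁ + ℕ→ℚ (σ' ℕ.* σ ℕ.^ suc m)
          ≡⟨ cong (λ x → b₁ + x) (trans (ℕ→ℚ-homo-* σ' (σ ℕ.^ suc m)) (cong (t *_) (ℕ→ℚ-σ^ (suc m)))) ⟩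
        b₁ + t * X ∎

    ∑-numTokens-ℚ : (n : ℕ) →
      ℕ→ℚ (∑[ x ∈ allStrings σ n ] numTokens x)
        ≡ s ^ℚ n + ½ * ℕ→ℚ (∑[ x ∈ allStrings σ n ] runs x) + ½ * ℕ→ℚ (∑[ x ∈ allStrings σ n ] parity (runs x))
    ∑-numTokens-ℚ n = begin
      ℕ→ℚ K
        ≡⟨ solve 1 (λ k → k := con ½ :* (con (ℕ→ℚ 2) :* k)) refl (ℕ→ℚ K) ⟩
      ½ * (ℕ→ℚ 2 * ℕ→ℚ K)
        ≡⟨ cong (½ *_) (ℕ→ℚ-homo-* 2 K) ⟨
      ½ * ℕ→ℚ (2 ℕ.* K)
        ≡⟨ cong (λ k → ½ * ℕ→ℚ k) (∑-numTokens σ n) ⟩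
      ½ * ℕ→ℚ (2 ℕ.* σ ℕ.^ n ℕ.+ A ℕ.+ B)
        ≡⟨ cong (½ *_) (trans (ℕ→ℚ-homo-+ (2 ℕ.* σ ℕ.^ n ℕ.+ A) B)
                              (cong (_+ ℕ→ℚ B) (ℕ→ℚ-homo-+ (2 ℕ.* σ ℕ.^ n) A))) ⟩
      ½ * (ℕ→ℚ (2 ℕ.* σ ℕ.^ n) + ℕ→ℚ A + ℕ→ℚ B)
        ≡⟨ cong (λ x → ½ * (x + ℕ→ℚ A + ℕ→ℚ B)) (trans (ℕ→ℚ-homo-* 2 (σ ℕ.^ n)) (cong (ℕ→ℚ 2 *_) (ℕ→ℚ-σ^ n))) ⟩
      ½ * (ℕ→ℚ 2 * s ^ℚ n + ℕ→ℚ A + ℕ→ℚ B)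
        ≡⟨ solve 3 (λ S a b → con ½ :* (con (ℕ→ℚ 2) :* S :+ a :+ b) := S :+ con ½ :* a :+ con ½ :* b)
                   refl (s ^ℚ n) (ℕ→ℚ A) (ℕ→ℚ B) ⟩
      s ^ℚ n + ½ * ℕ→ℚ A + ½ * ℕ→ℚ B ∎
      where
      open ≡-Reasoning
      T = allStrings σ n
      K = ∑[ x ∈ T ] numTokens x
      A = ∑[ x ∈ T ] runs x
      B = ∑[ x ∈ T ] parity (runs x)

    expect-numTokens : (m : ℕ) → expect σ (suc m) numTokens ≡ 1ℚ + (1ℚ + ℕ→ℚ m * p) * ½ + (1ℚ + q ^ℚ m) * ¼
    expect-numTokens m =
      /ℕ-unique (∑[ x ∈ T ] numTokens x) E (length-allStrings-pos (suc m)) (begin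
        E * ℕ→ℚ (length T)
          ≡⟨ cong (E *_) (length-allStrings-ℚ (suc m)) ⟩
        E * X
          ≡⟨ solve 4 (λ m̂ p W X →
                  (con 1ℚ :+ (con 1ℚ :+ m̂ :* p) :* con ½ :+ (con 1ℚ :+ W) :* con ¼) :* X
               := X :+ con ½ :* ((con 1ℚ :+ m̂ :* p) :* X) :+ con ½ :* ((con 1ℚ :+ W) :* con ½ :* X))
                     refl (ℕ→ℚ m) p (q ^ℚ m) X ⟩
        X + ½ * ((1ℚ + ℕ→ℚ m * p) * X) + ½ * ((1ℚ + q ^ℚ m) * ½ * X)
          ≡⟨ cong₂ (λ a b → X + ½ * a + ½ * b) (∑-runs-ℚ m) (∑-parity-runs-ℚ m) ⟨
        X + ½ * ℕ→ℚ (∑[ x ∈ T ] runs x) + ½ * ℕ→ℚ (∑[ x ∈ T ] parity (runs x))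
          ≡⟨ ∑-numTokens-ℚ (suc m) ⟨
        ℕ→ℚ (∑[ x ∈ T ] numTokens x) ∎)
      where
      open ≡-Reasoning
      T = allStrings σ (suc m)
      X = s ^ℚ suc m
      E = 1ℚ + (1ℚ + ℕ→ℚ m * p) * ½ + (1ℚ + q ^ℚ m) * ¼

    linear-term : (m : ℕ) → (+ (suc m ℕ.* (σ ∸ 1))) /ℕ (2 ℕ.* σ) ≡ ℕ→ℚ (suc m) * p * ½
    linear-term m = /ℕ-unique (suc m ℕ.* σ') (ℕ→ℚ (suc m) * p * ½) (ℕ.s≤s ℕ.z≤n) (begin
      ℕ→ℚ (suc m) * p * ½ * ℕ→ℚ (2 ℕ.* σ)
        ≡⟨ cong (ℕ→ℚ (suc m) * p * ½ *_) (trans (ℕ→ℚ-homo-* 2 σ) (cong (ℕ→ℚ 2 *_) ℕ→ℚ-σ)) ⟩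
      ℕ→ℚ (suc m) * p * ½ * (ℕ→ℚ 2 * s)
        ≡⟨ solve 3 (λ n p s → n :* p :* con ½ :* (con (ℕ→ℚ 2) :* s) := n :* (p :* s)) refl (ℕ→ℚ (suc m)) p s ⟩
      ℕ→ℚ (suc m) * (p * s)
        ≡⟨ cong (ℕ→ℚ (suc m) *_) p*s≡t ⟩
      ℕ→ℚ (suc m) * t
        ≡⟨ ℕ→ℚ-homo-* (suc m) σ' ⟨
      ℕ→ℚ (suc m ℕ.* σ') ∎)
      where open ≡-Reasoning

    expect-numTokens-minus-linear-term : (m : ℕ) →
      expect σ (suc m) numTokens - (+ (suc m ℕ.* (σ ∸ 1))) /ℕ (2 ℕ.* σ) ≡ (1ℚ + ¼ + ½ * u) + ¼ * q ^ℚ m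
    expect-numTokens-minus-linear-term m = begin
      expect σ (suc m) numTokens - (+ (suc m ℕ.* (σ ∸ 1))) /ℕ (2 ℕ.* σ)
        ≡⟨ cong₂ _-_ (expect-numTokens m) (linear-term m) ⟩
      1ℚ + (1ℚ + m̂ * p) * ½ + (1ℚ + W) * ¼ - ℕ→ℚ (suc m) * p * ½
        ≡⟨ cong (λ n → 1ℚ + (1ℚ + m̂ * p) * ½ + (1ℚ + W) * ¼ - n * p * ½) (ℕ→ℚ-homo-+ 1 m) ⟩
      1ℚ + (1ℚ + m̂ * p) * ½ + (1ℚ + W) * ¼ - (1ℚ + m̂) * p * ½
        ≡⟨ solve 3 (λ m̂ p W → con 1ℚ :+ (con 1ℚ :+ m̂ :* p) :* con ½ :+ (con 1ℚ :+ W) :* con ¼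
                                :- (con 1ℚ :+ m̂) :* p :* con ½
                            := con 1ℚ :+ con ¼ :+ con ½ :* (con 1ℚ :- p) :+ con ¼ :* W) refl m̂ p W ⟩
      1ℚ + ¼ + ½ * (1ℚ - p) + ¼ * W
        ≡⟨ cong (λ x → 1ℚ + ¼ + ½ * x + ¼ * W) 1-p≡u ⟩
      1ℚ + ¼ + ½ * u + ¼ * W  ∎
      where
      open ≡-Reasoning
      m̂ = ℕ→ℚ m
      W = q ^ℚ m

    expect-numTokens-deviation : (m : ℕ) →
      ∣ expect σ (suc m) numTokens - (+ (suc m ℕ.* (σ ∸ 1))) /ℕ (2 ℕ.* σ) ∣ ≤ ℕ→ℚ 2
    expect-numTokens-deviation m = begin
      ∣ expect σ (suc m) numTokens - (+ (suc m ℕ.* (σ ∸ 1))) /ℕ (2 ℕ.* σ) ∣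
        ≡⟨ cong ∣_∣ (expect-numTokens-minus-linear-term m) ⟩
      ∣ 1ℚ + ¼ + ½ * u + ¼ * q ^ℚ m ∣
        ≤⟨ ∣p+q∣≤∣p∣+∣q∣ (1ℚ + ¼ + ½ * u) (¼ * q ^ℚ m) ⟩
      ∣ 1ℚ + ¼ + ½ * u ∣ + ∣ ¼ * q ^ℚ m ∣
        ≤⟨ +-monoˡ-≤ ∣ ¼ * q ^ℚ m ∣ (∣p+q∣≤∣p∣+∣q∣ (1ℚ + ¼) (½ * u)) ⟩
      ∣ 1ℚ + ¼ ∣ + ∣ ½ * u ∣ + ∣ ¼ * q ^ℚ m ∣
        ≡⟨ cong₂ (λ x y → ∣ 1ℚ + ¼ ∣ + x + y) (∣p*q∣≡∣p∣*∣q∣ ½ u) (∣p*q∣≡∣p∣*∣q∣ ¼ (q ^ℚ m)) ⟩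
      ∣ 1ℚ + ¼ ∣ + ½ * ∣ u ∣ + ¼ * ∣ q ^ℚ m ∣
        ≤⟨ +-mono-≤ (+-monoʳ-≤ ∣ 1ℚ + ¼ ∣ (*-monoˡ-≤-nonNeg ½ ∣u∣≤1)) (*-monoˡ-≤-nonNeg ¼ (∣^ℚ∣≤1 q m ∣q∣≤1)) ⟩
      ∣ 1ℚ + ¼ ∣ + ½ * 1ℚ + ¼ * 1ℚ
        ≡⟨⟩
      ℕ→ℚ 2 ∎
      where
      open ≤-Reasoning
      ∣u∣≤1 : ∣ u ∣ ≤ 1ℚ
      ∣u∣≤1 = ∣/suc∣≤1 (+ 1) σ' (ℕ.s≤s ℕ.z≤n)
      ∣q∣≤1 : ∣ q ∣ ≤ 1ℚ
      ∣q∣≤1 = ∣/suc∣≤1 (2 ⊖ σ) σ' (∣2⊖[1+n]∣≤1+n σ')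

open import Data.Nat using (_≤_)
open import Data.Product using (_×_; ∃)
open import Data.Integer using (+_; _⊖_)
open import Data.Rational using (ℚ; 1ℚ; _+_; _*_; _-_; ∣_∣)
import Data.Rational as Q

mainTheorem7 : (σ : ℕ) → 2 ≤ σ →
    ((n : ℕ) → 2 ≤ n →
      ((j : ℕ) → prob σ n (λ s → (runs s ∸ 1) ≡ᵇ j)
                   ≡ binomialPMF (n ∸ 1) ((+ (σ ∸ 1)) /ℕ σ) j)
      × (expect σ n numTokens
           ≡ 1ℚ + (1ℚ + ℕ→ℚ (n ∸ 1) * ((+ (σ ∸ 1)) /ℕ σ)) * ((+ 1) /ℕ 2)
                + (1ℚ + ((2 ⊖ σ) /ℕ σ) ^ℚ (n ∸ 1)) * ((+ 1) /ℕ 4)))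
    × ∃ λ (C : ℚ) → (n : ℕ) → 2 ≤ n →
        ∣ expect σ n numTokens - (+ (n Data.Nat.* (σ ∸ 1))) /ℕ (2 Data.Nat.* σ) ∣ Q.≤ C
mainTheorem7 zero     ()
mainTheorem7 (suc σ') _ =
  (λ where
     (suc m) _ → runs-distribution σ' m , expect-numTokens σ' m)
  , ℕ→ℚ 2
  , λ where
      (suc m) _ → expect-numTokens-deviation σ' m
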